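{- Let $\Gamma\le S_m$ and let $a_1,\dots,a_m\ge 2$ be integers. Let $O_1,\dots,O_t$ be the orbits of the action of the commutator subgroup $[\Gamma,\Gamma]$ on $[m]$, and for each $i$ let $n_i=\min\{a_j: j\in O_i\}$. Then \[R_\Gamma(a_1,a_2,\dots,a_m)\le R(n_1,n_2,\dots,n_t).\]
   Context: An $m$-edge-coloured complete graph is a complete graph with each edge coloured from $[m]=\{1,\dots,m\}$. For $\Gamma\le S_m$, $\pi\in\Gamma$ and a vertex $v$, switching at $v$ with $\pi$ recolours every edge incident with $v$ of colour $i$ to colour $\pi(i)$, leaving other edges unchanged. Two such graphs on the same vertex set are $\Gamma$-switch equivalent if one is obtained from the other by a finite sequence of switches. $K_t^{(i)}$ is a complete graph on $t$ vertices with all edges of colour $i$. $R_\Gamma(a_1,\dots,a_m)$ is the least $n$ such that every $m$-edge-coloured complete graph on $n$ vertices is $\Gamma$-switch equivalent to one containing, for some $i$, a copy of $K_{a_i}^{(i)}$. $R(\cdot)$ is the classical multicolour Ramsey number. $[\Gamma,\Gamma]$ is the commutator subgroup of $\Gamma$. -}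

module Defs where

open import Data.Nat using (ℕ; _≤_)
open import Data.Fin using (Fin; _≟_)
open import Data.Fin.Permutation using (Permutation′; _⟨$⟩ʳ_; _∘ₚ_; flip; id; _≈_)
open import Data.Product using (Σ; ∃; ∃-syntax; _×_; _,_)
open import Relation.Binary.PropositionalEquality using (_≡_; _≢_)
open import Relation.Nullary using (yes; no)
open import Function.Definitions using (Injective)
open import Function.Bundles using (_⇔_)

record IsSubgroup {m : ℕ} (Γ : Permutation′ m → Set) : Set where
  field
    resp   : ∀ {π ρ} → π ≈ ρ → Γ π → Γ ρ
    has-id : Γ id
    ∘-cl   : ∀ {π ρ} → Γ π → Γ ρ → Γ (π ∘ₚ ρ)
    inv-cl : ∀ {π} → Γ π → Γ (flip π)

commutator : {m : ℕ} → Permutation′ m → Permutation′ m → Permutation′ m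
commutator g h = flip g ∘ₚ flip h ∘ₚ g ∘ₚ h

data Commutator {m : ℕ} (Γ : Permutation′ m → Set) : Permutation′ m → Set where
  gen  : ∀ {g h} → Γ g → Γ h → Commutator Γ (commutator g h)
  one  : Commutator Γ id
  mul  : ∀ {π ρ} → Commutator Γ π → Commutator Γ ρ → Commutator Γ (π ∘ₚ ρ)
  inv  : ∀ {π} → Commutator Γ π → Commutator Γ (flip π)
  resp : ∀ {π ρ} → π ≈ ρ → Commutator Γ π → Commutator Γ ρ

SameOrbit : {m : ℕ} → (Permutation′ m → Set) → Fin m → Fin m → Set
SameOrbit Δ i j = ∃[ ρ ] (Δ ρ × ρ ⟨$⟩ʳ i ≡ j)

-- An m-edge-coloured complete graph on vertex set Fin N: a colouring of
-- ordered pairs which is symmetric; the diagonal is irrelevant.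
Colouring : ℕ → ℕ → Set
Colouring N m = Fin N → Fin N → Fin m

Symmetric : {N m : ℕ} → Colouring N m → Set
Symmetric c = ∀ u v → c u v ≡ c v u

SameColouring : {N m : ℕ} → Colouring N m → Colouring N m → Set
SameColouring c d = ∀ u v → u ≢ v → c u v ≡ d u v

HasMono : {N m : ℕ} → Colouring N m → Fin m → ℕ → Set
HasMono {N} c i a =
  Σ (Fin a → Fin N) λ f → Injective _≡_ _≡_ f × (∀ x y → x ≢ y → c (f x) (f y) ≡ i)

switch : {N m : ℕ} → Permutation′ m → Fin N → Colouring N m → Colouring N m
switch π v c u w with u ≟ v | w ≟ v
... | yes _ | yes _ = c u w
... | yes _ | no _  = π ⟨$⟩ʳ c u w
... | no _  | yes _ = π ⟨$⟩ʳ c u w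
... | no _  | no _  = c u w

data SwitchEquiv {N m : ℕ} (Γ : Permutation′ m → Set) :
     Colouring N m → Colouring N m → Set where
  done : ∀ {c d} → SameColouring c d → SwitchEquiv Γ c d
  step : ∀ {c d} (π : Permutation′ m) (v : Fin N) → Γ π →
         SwitchEquiv Γ (switch π v c) d → SwitchEquiv Γ c d

RamseyProp : {t : ℕ} → (Fin t → ℕ) → ℕ → Set
RamseyProp {t} b N =
  (c : Colouring N t) → Symmetric c → ∃[ k ] HasMono c k (b k)

SwitchRamseyProp : {m : ℕ} → (Permutation′ m → Set) → (Fin m → ℕ) → ℕ → Set
SwitchRamseyProp {m} Γ a N =
  (c : Colouring N m) → Symmetric c →
  ∃[ d ] (SwitchEquiv Γ c d × ∃[ i ] HasMono d i (a i))

IsLeast : (ℕ → Set) → ℕ → Set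
IsLeast P N = P N × (∀ M → P M → N ≤ M)

IsRamseyNumber : {t : ℕ} → (Fin t → ℕ) → ℕ → Set
IsRamseyNumber b N = IsLeast (RamseyProp b) N

IsSwitchRamseyNumber : {m : ℕ} → (Permutation′ m → Set) → (Fin m → ℕ) → ℕ → Set
IsSwitchRamseyNumber Γ a N = IsLeast (SwitchRamseyProp Γ a) N

IsOrbitLabelling : {m t : ℕ} → (Permutation′ m → Set) → (Fin m → Fin t) → Set
IsOrbitLabelling {m} {t} Δ orb =
  (∀ k → ∃[ i ] orb i ≡ k) × (∀ i j → (orb i ≡ orb j) ⇔ SameOrbit Δ i j)

IsOrbitMin : {m t : ℕ} → (Fin m → Fin t) → (Fin m → ℕ) → (Fin t → ℕ) → Set
IsOrbitMin orb a n =
  ∀ k → (∃[ j ] (orb j ≡ k × n k ≡ a j)) × (∀ j → orb j ≡ k → n k ≤ a j)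

-- Switching at u with g⁻¹, at v with h⁻¹, at u with g and at v with h recolours
-- the edge uv by the commutator [g,h] and every other edge by the identity, since
-- any other edge meets at most one of u and v. Composing such moves, every
-- element of [Γ,Γ] can be applied to a single edge, leaving the rest untouched.
-- Now colour each edge of K_N, N = R(n_1,…,n_t), by the [Γ,Γ]-orbit of its
-- colour: this yields a clique of size n_k all of whose colours lie in orbit
-- O_k. Choosing j ∈ O_k with a_j = n_k, we move the colour of every clique edge
-- to j, one edge at a time, and obtain a copy of K_{a_j}^{(j)}.
module Submission where

open import Defs
open import Data.Nat using (ℕ; _≤_)
open import Data.Fin using (Fin; _≟_)
open import Data.Fin.Permutation
  using (Permutation′; _⟨$⟩ʳ_; _⟨$⟩ˡ_; flip; id; _≈_; inverseˡ; inverseʳ)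
open import Data.Product using (∃-syntax; _×_; _,_; proj₁; proj₂)
open import Data.Sum using (_⊎_; inj₁; inj₂)
open import Data.Empty using (⊥-elim)
open import Data.List using (List; []; _∷_; cartesianProduct; allFin)
open import Data.List.Membership.Propositional using (_∈_)
open import Data.List.Membership.Propositional.Properties
  using (∈-cartesianProduct⁺; ∈-allFin)
open import Data.List.Relation.Unary.Any using (here; there)
open import Function using (_∘_)
open import Function.Definitions using (Injective)
open import Function.Bundles using (Equivalence)
open import Relation.Binary.PropositionalEquality
  using (_≡_; _≢_; refl; sym; trans; cong; subst; module ≡-Reasoning)
open import Relation.Nullary using (¬_; Dec; yes; no; _×-dec_; _⊎-dec_)

≈⇒⟨$⟩ˡ-≡ : ∀ {m} {π ρ : Permutation′ m} → π ≈ ρ → ∀ x → π ⟨$⟩ˡ x ≡ ρ ⟨$⟩ˡ x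
≈⇒⟨$⟩ˡ-≡ {π = π} {ρ} π≈ρ x = begin
  π ⟨$⟩ˡ x                         ≡⟨ inverseˡ ρ ⟨
  ρ ⟨$⟩ˡ (ρ ⟨$⟩ʳ (π ⟨$⟩ˡ x))       ≡⟨ cong (ρ ⟨$⟩ˡ_) (π≈ρ (π ⟨$⟩ˡ x)) ⟨
  ρ ⟨$⟩ˡ (π ⟨$⟩ʳ (π ⟨$⟩ˡ x))       ≡⟨ cong (ρ ⟨$⟩ˡ_) (inverseʳ π) ⟩
  ρ ⟨$⟩ˡ x                         ∎
  where open ≡-Reasoning

applyIf : ∀ {m} {P : Set} → Dec P → Permutation′ m → Fin m → Fin m
applyIf (yes _) π = π ⟨$⟩ʳ_
applyIf (no _)  _ = λ x → x

applyIf-commutator : ∀ {m} {P Q : Set} (P? : Dec P) (Q? : Dec Q) → P → Q →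
  (g h : Permutation′ m) → ∀ x →
  applyIf Q? h (applyIf P? g (applyIf Q? (flip h) (applyIf P? (flip g) x)))
    ≡ commutator g h ⟨$⟩ʳ x
applyIf-commutator (yes _) (yes _) _ _ _ _ _ = refl
applyIf-commutator (no ¬p) _       p _ _ _ _ = ⊥-elim (¬p p)
applyIf-commutator (yes _) (no ¬q) _ q _ _ _ = ⊥-elim (¬q q)

applyIf-cancel : ∀ {m} {P Q : Set} (P? : Dec P) (Q? : Dec Q) → ¬ (P × Q) →
  (g h : Permutation′ m) → ∀ x →
  applyIf Q? h (applyIf P? g (applyIf Q? (flip h) (applyIf P? (flip g) x))) ≡ x
applyIf-cancel (yes p) (yes q) ¬pq _ _ _ = ⊥-elim (¬pq (p , q))
applyIf-cancel (yes _) (no _)  _   g _ _ = inverseʳ g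
applyIf-cancel (no _)  (yes _) _   _ h _ = inverseʳ h
applyIf-cancel (no _)  (no _)  _   _ _ _ = refl

module _ {N : ℕ} where

  Incident : Fin N → Fin N → Fin N → Set
  Incident v p q = p ≡ v ⊎ q ≡ v

  incident? : ∀ v p q → Dec (Incident v p q)
  incident? v p q = (p ≟ v) ⊎-dec (q ≟ v)

  OnEdge : Fin N → Fin N → Fin N → Fin N → Set
  OnEdge u v p q = (p ≡ u × q ≡ v) ⊎ (p ≡ v × q ≡ u)

  onEdge? : ∀ u v p q → Dec (OnEdge u v p q)
  onEdge? u v p q = ((p ≟ u) ×-dec (q ≟ v)) ⊎-dec ((p ≟ v) ×-dec (q ≟ u))

  OnEdge-sym : ∀ {u v p q} → OnEdge u v p q → OnEdge u v q p
  OnEdge-sym (inj₁ (p≡u , q≡v)) = inj₂ (q≡v , p≡u)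
  OnEdge-sym (inj₂ (p≡v , q≡u)) = inj₁ (q≡u , p≡v)

  OnEdge⇒≢ : ∀ {u v p q} → u ≢ v → OnEdge u v p q → p ≢ q
  OnEdge⇒≢ u≢v (inj₁ (refl , refl)) = u≢v
  OnEdge⇒≢ u≢v (inj₂ (refl , refl)) = u≢v ∘ sym

  OnEdge⇒incident : ∀ {u v p q} → OnEdge u v p q → Incident u p q × Incident v p q
  OnEdge⇒incident (inj₁ (p≡u , q≡v)) = inj₁ p≡u , inj₂ q≡v
  OnEdge⇒incident (inj₂ (p≡v , q≡u)) = inj₂ q≡u , inj₁ p≡v

  incident⇒OnEdge : ∀ {u v p q} → u ≢ v → p ≢ q →
    Incident u p q → Incident v p q → OnEdge u v p q
  incident⇒OnEdge u≢v _   (inj₁ refl) (inj₁ refl) = ⊥-elim (u≢v refl)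
  incident⇒OnEdge _   _   (inj₁ p≡u)  (inj₂ q≡v)  = inj₁ (p≡u , q≡v)
  incident⇒OnEdge _   _   (inj₂ q≡u)  (inj₁ p≡v)  = inj₂ (p≡v , q≡u)
  incident⇒OnEdge u≢v _   (inj₂ refl) (inj₂ refl) = ⊥-elim (u≢v refl)

  OnEdge-colour : ∀ {m} {c : Colouring N m} {u v p q} → Symmetric c →
    OnEdge u v p q → c p q ≡ c u v
  OnEdge-colour _     (inj₁ (refl , refl)) = refl
  OnEdge-colour c-sym (inj₂ (refl , refl)) = c-sym _ _

module _ {N m : ℕ} where

  switch-edge : ∀ (π : Permutation′ m) v (c : Colouring N m) {p q} → p ≢ q →
    switch π v c p q ≡ applyIf (incident? v p q) π (c p q)
  switch-edge π v c {p} {q} p≢q with p ≟ v | q ≟ v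
  ... | yes refl | yes refl = ⊥-elim (p≢q refl)
  ... | yes _    | no _     = refl
  ... | no _     | yes _    = refl
  ... | no _     | no _     = refl

  switch-resp : ∀ (π : Permutation′ m) v {c c′ : Colouring N m} →
    SameColouring c c′ → SameColouring (switch π v c) (switch π v c′)
  switch-resp π v {c} {c′} c≗c′ p q p≢q = begin
    switch π v c p q                         ≡⟨ switch-edge π v c p≢q ⟩
    applyIf (incident? v p q) π (c p q)      ≡⟨ cong (applyIf (incident? v p q) π) (c≗c′ p q p≢q) ⟩
    applyIf (incident? v p q) π (c′ p q)     ≡⟨ switch-edge π v c′ p≢q ⟨
    switch π v c′ p q                        ∎
    where open ≡-Reasoning

module _ {N m : ℕ} {Γ : Permutation′ m → Set} where

  SwitchEquiv-refl : {c : Colouring N m} → SwitchEquiv Γ c c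
  SwitchEquiv-refl = done (λ _ _ _ → refl)

  SwitchEquiv-respˡ : {c c′ d : Colouring N m} → SameColouring c c′ →
    SwitchEquiv Γ c′ d → SwitchEquiv Γ c d
  SwitchEquiv-respˡ c≗c′ (done c′≗d) =
    done (λ p q p≢q → trans (c≗c′ p q p≢q) (c′≗d p q p≢q))
  SwitchEquiv-respˡ c≗c′ (step π v π∈Γ e) =
    step π v π∈Γ (SwitchEquiv-respˡ (switch-resp π v c≗c′) e)

  SwitchEquiv-trans : {c d e : Colouring N m} →
    SwitchEquiv Γ c d → SwitchEquiv Γ d e → SwitchEquiv Γ c e
  SwitchEquiv-trans (done c≗d)         d~e = SwitchEquiv-respˡ c≗d d~e
  SwitchEquiv-trans (step π v π∈Γ c~d) d~e = step π v π∈Γ (SwitchEquiv-trans c~d d~e)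

  Recolourable : (Fin m → Fin m) → Set
  Recolourable f = ∀ (c : Colouring N m) {u v} → u ≢ v →
    ∃[ d ] SwitchEquiv Γ c d
         × (∀ {p q} → OnEdge u v p q → d p q ≡ f (c p q))
         × (∀ {p q} → p ≢ q → ¬ OnEdge u v p q → d p q ≡ c p q)

  Recolourable-id : Recolourable (λ x → x)
  Recolourable-id c _ = c , SwitchEquiv-refl , (λ _ → refl) , (λ _ _ → refl)

  Recolourable-∘ : ∀ {f g} → Recolourable f → Recolourable g → Recolourable (f ∘ g)
  Recolourable-∘ {f} rf rg c u≢v with rg c u≢v
  ... | d , c~d , d-on , d-off with rf d u≢v
  ... | e , d~e , e-on , e-off =
    e , SwitchEquiv-trans c~d d~e ,
    (λ on → trans (e-on on) (cong f (d-on on))) ,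
    (λ p≢q off → trans (e-off p≢q off) (d-off p≢q off))

  Recolourable-resp : ∀ {f g} → (∀ x → f x ≡ g x) → Recolourable f → Recolourable g
  Recolourable-resp f≗g rf c u≢v with rf c u≢v
  ... | d , c~d , d-on , d-off = d , c~d , (λ on → trans (d-on on) (f≗g _)) , d-off

module _ {N m : ℕ} {Γ : Permutation′ m → Set} (Γ-subgroup : IsSubgroup Γ) where
  open IsSubgroup Γ-subgroup

  commutator-recolourable : ∀ {g h} → Γ g → Γ h →
    Recolourable {N} {Γ = Γ} (commutator g h ⟨$⟩ʳ_)
  commutator-recolourable {g} {h} g∈Γ h∈Γ c {u} {v} u≢v =
    d , c~d , on-edge , off-edge
    where
    c₁ c₂ c₃ d : Colouring N m
    c₁ = switch (flip g) u c
    c₂ = switch (flip h) v c₁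
    c₃ = switch g u c₂
    d  = switch h v c₃

    c~d : SwitchEquiv Γ c d
    c~d = step (flip g) u (inv-cl g∈Γ) (step (flip h) v (inv-cl h∈Γ)
            (step g u g∈Γ (step h v h∈Γ SwitchEquiv-refl)))

    four-switches : ∀ {p q} → p ≢ q → d p q ≡
      applyIf (incident? v p q) h (applyIf (incident? u p q) g
        (applyIf (incident? v p q) (flip h) (applyIf (incident? u p q) (flip g) (c p q))))
    four-switches {p} {q} p≢q = begin
      d p q                         ≡⟨ switch-edge h v c₃ p≢q ⟩
      applyIf Iv h (c₃ p q)         ≡⟨ cong (applyIf Iv h) (switch-edge g u c₂ p≢q) ⟩
      applyIf Iv h (applyIf Iu g (c₂ p q))
        ≡⟨ cong (applyIf Iv h ∘ applyIf Iu g) (switch-edge (flip h) v c₁ p≢q) ⟩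
      applyIf Iv h (applyIf Iu g (applyIf Iv (flip h) (c₁ p q)))
        ≡⟨ cong (applyIf Iv h ∘ applyIf Iu g ∘ applyIf Iv (flip h))
                (switch-edge (flip g) u c p≢q) ⟩
      applyIf Iv h (applyIf Iu g (applyIf Iv (flip h) (applyIf Iu (flip g) (c p q)))) ∎
      where
      open ≡-Reasoning
      Iu : Dec (Incident u p q)
      Iu = incident? u p q
      Iv : Dec (Incident v p q)
      Iv = incident? v p q

    on-edge : ∀ {p q} → OnEdge u v p q → d p q ≡ commutator g h ⟨$⟩ʳ c p q
    on-edge {p} {q} on =
      trans (four-switches (OnEdge⇒≢ u≢v on))
        (applyIf-commutator (incident? u p q) (incident? v p q) pu pv g h (c p q))
      where
      pu : Incident u p q
      pu = proj₁ (OnEdge⇒incident on)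
      pv : Incident v p q
      pv = proj₂ (OnEdge⇒incident on)

    off-edge : ∀ {p q} → p ≢ q → ¬ OnEdge u v p q → d p q ≡ c p q
    off-edge {p} {q} p≢q off =
      trans (four-switches p≢q)
        (applyIf-cancel (incident? u p q) (incident? v p q)
          (λ (pu , pv) → off (incident⇒OnEdge u≢v p≢q pu pv)) g h (c p q))

  -- The inverse is carried along so that the inv case goes through.
  commutatorSubgroup-recolourable : ∀ {π} → Commutator Γ π →
    Recolourable {N} {Γ = Γ} (π ⟨$⟩ʳ_) × Recolourable {N} {Γ = Γ} (π ⟨$⟩ˡ_)
  commutatorSubgroup-recolourable (gen g∈Γ h∈Γ) =
    commutator-recolourable g∈Γ h∈Γ , commutator-recolourable h∈Γ g∈Γ
  commutatorSubgroup-recolourable one = Recolourable-id , Recolourable-id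
  commutatorSubgroup-recolourable (mul {π} {ρ} π∈ ρ∈)
    with commutatorSubgroup-recolourable π∈ | commutatorSubgroup-recolourable ρ∈
  ... | πʳ , πˡ | ρʳ , ρˡ =
    Recolourable-∘ {f = ρ ⟨$⟩ʳ_} {g = π ⟨$⟩ʳ_} ρʳ πʳ ,
    Recolourable-∘ {f = π ⟨$⟩ˡ_} {g = ρ ⟨$⟩ˡ_} πˡ ρˡ
  commutatorSubgroup-recolourable (inv π∈) with commutatorSubgroup-recolourable π∈
  ... | πʳ , πˡ = πˡ , πʳ
  commutatorSubgroup-recolourable (resp {π} {ρ} π≈ρ π∈) with commutatorSubgroup-recolourable π∈
  ... | πʳ , πˡ = Recolourable-resp π≈ρ πʳ , Recolourable-resp (≈⇒⟨$⟩ˡ-≡ {π = π} {ρ} π≈ρ) πˡ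

  recolour-edge : ∀ {c : Colouring N m} {u v j} → Symmetric c → u ≢ v →
    SameOrbit (Commutator Γ) (c u v) j →
    ∃[ d ] SwitchEquiv Γ c d × Symmetric d × d u v ≡ j
         × (∀ {p q} → p ≢ q → d p q ≡ c p q ⊎ d p q ≡ j)
  recolour-edge {c} {u} {v} {j} c-sym u≢v (ρ , ρ∈ , ρ-cuv)
    with proj₁ (commutatorSubgroup-recolourable ρ∈) c u≢v
  ... | d , c~d , d-on , d-off =
    d , c~d , d-sym , on-edge (inj₁ (refl , refl)) , changed
    where
    on-edge : ∀ {p q} → OnEdge u v p q → d p q ≡ j
    on-edge on = trans (d-on on) (trans (cong (ρ ⟨$⟩ʳ_) (OnEdge-colour c-sym on)) ρ-cuv)

    d-sym : Symmetric d
    d-sym p q with p ≟ q | onEdge? u v p q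
    ... | yes refl | _      = refl
    ... | no _     | yes on = trans (on-edge on) (sym (on-edge (OnEdge-sym on)))
    ... | no p≢q   | no off =
      trans (d-off p≢q off)
        (trans (c-sym p q) (sym (d-off (p≢q ∘ sym) (off ∘ OnEdge-sym))))

    changed : ∀ {p q} → p ≢ q → d p q ≡ c p q ⊎ d p q ≡ j
    changed {p} {q} p≢q with onEdge? u v p q
    ... | yes on = inj₂ (on-edge on)
    ... | no off = inj₁ (d-off p≢q off)

  module _ {s} (f : Fin s → Fin N) (f-inj : Injective _≡_ _≡_ f) (j : Fin m) where

    CliqueInOrbit : Colouring N m → Set
    CliqueInOrbit d = ∀ {x y} → x ≢ y → SameOrbit (Commutator Γ) (d (f x) (f y)) j

    recolour-pairs : (L : List (Fin s × Fin s)) {c : Colouring N m} →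
      Symmetric c → CliqueInOrbit c →
      ∃[ d ] SwitchEquiv Γ c d × Symmetric d × CliqueInOrbit d
           × (∀ {x y} → (x , y) ∈ L → x ≢ y → d (f x) (f y) ≡ j)
    recolour-pairs [] c-sym c-orb = _ , SwitchEquiv-refl , c-sym , c-orb , λ ()
    recolour-pairs ((x , y) ∷ L) c-sym c-orb with recolour-pairs L c-sym c-orb
    ... | d , c~d , d-sym , d-orb , d-L with x ≟ y
    ...   | yes refl =
      d , c~d , d-sym , d-orb ,
      λ { (here refl) x≢x → ⊥-elim (x≢x refl) ; (there xy∈L) → d-L xy∈L }
    ...   | no x≢y with recolour-edge d-sym (x≢y ∘ f-inj) (d-orb x≢y)
    ...     | e , d~e , e-sym , e-xy , changed =
      e , SwitchEquiv-trans c~d d~e , e-sym , e-orb , e-L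
      where
      e-orb : CliqueInOrbit e
      e-orb x′≢y′ with changed (x′≢y′ ∘ f-inj)
      ... | inj₁ same = subst (λ k → SameOrbit (Commutator Γ) k j) (sym same) (d-orb x′≢y′)
      ... | inj₂ is-j = subst (λ k → SameOrbit (Commutator Γ) k j) (sym is-j) (id , one , refl)

      e-L : ∀ {x′ y′} → (x′ , y′) ∈ ((x , y) ∷ L) → x′ ≢ y′ → e (f x′) (f y′) ≡ j
      e-L (here refl) _ = e-xy
      e-L (there xy∈L) x′≢y′ with changed (x′≢y′ ∘ f-inj)
      ... | inj₁ same = trans same (d-L xy∈L x′≢y′)
      ... | inj₂ is-j = is-j

    clique-recolour : {c : Colouring N m} → Symmetric c → CliqueInOrbit c →
      ∃[ d ] SwitchEquiv Γ c d × HasMono d j s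
    clique-recolour c-sym c-orb
      with recolour-pairs (cartesianProduct (allFin s) (allFin s)) c-sym c-orb
    ... | d , c~d , _ , _ , d-L =
      d , c~d , f , f-inj ,
      λ x y → d-L (∈-cartesianProduct⁺ (∈-allFin x) (∈-allFin y))

  ramsey⇒switchRamsey : ∀ {t} {orb : Fin m → Fin t} {a : Fin m → ℕ} {n : Fin t → ℕ} →
    IsOrbitLabelling (Commutator Γ) orb → IsOrbitMin orb a n →
    RamseyProp n N → SwitchRamseyProp Γ a N
  ramsey⇒switchRamsey {orb = orb} (_ , same-label⇔same-orbit) orbit-min ramsey c c-sym
    with ramsey (λ u v → orb (c u v)) (λ u v → cong orb (c-sym u v))
  ... | k , f , f-inj , orb-mono with proj₁ (orbit-min k)
  ... | j , orb-j , nₖ≡aⱼ =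
    let d , c~d , d-mono = clique-recolour f f-inj j c-sym c-orb
    in d , c~d , j , subst (HasMono d j) nₖ≡aⱼ d-mono
    where
    c-orb : CliqueInOrbit f f-inj j c
    c-orb {x} {y} x≢y =
      Equivalence.to (same-label⇔same-orbit (c (f x) (f y)) j)
        (trans (orb-mono x y x≢y) (sym orb-j))

theorem7 : (m : ℕ) (Γ : Permutation′ m → Set) → IsSubgroup Γ →
    (a : Fin m → ℕ) → (∀ i → 2 ≤ a i) →
    (t : ℕ) (orb : Fin m → Fin t) → IsOrbitLabelling (Commutator Γ) orb →
    (n : Fin t → ℕ) → IsOrbitMin orb a n →
    (R RΓ : ℕ) → IsRamseyNumber n R → IsSwitchRamseyNumber Γ a RΓ →
    RΓ ≤ R
theorem7 m Γ Γ-subgroup a _ t orb labelling n orbit-min R RΓ (R-ramsey , _) (_ , RΓ-least) =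
  RΓ-least R (ramsey⇒switchRamsey Γ-subgroup labelling orbit-min R-ramsey)
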